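{- Let $U$ be a set with at least two elements and $\sigma,\pi$ partitions on $U$. Then $\partial^\pi\sigma\wedge\left((\sigma\Rightarrow\pi)\Rightarrow\pi\right)=\sigma\vee\pi$, where $\partial^\pi\sigma=\sigma\vee(\sigma\Rightarrow\pi)$.
   Context: A partition on $U$ is a set of nonempty pairwise disjoint blocks with union $U$; $\operatorname{dit}(\pi)$ is the set of ordered pairs $(u,u')$ with $u,u'$ in different blocks; partitions are identified by their dit sets. For $S\subseteq U\times U$, $\overline S$ is the smallest equivalence relation containing $S$ and $\operatorname{int}(S)=U\times U\setminus\overline{U\times U\setminus S}$. Operations: $\operatorname{dit}(\sigma\vee\tau)=\operatorname{dit}\sigma\cup\operatorname{dit}\tau$ (blocks are nonempty intersections of blocks); $\operatorname{dit}(\sigma\wedge\tau)=\operatorname{int}(\operatorname{dit}\sigma\cap\operatorname{dit}\tau)$; $\operatorname{dit}(\sigma\Rightarrow\tau)=\operatorname{int}((U\times U\setminus\operatorname{dit}\sigma)\cup\operatorname{dit}\tau)$. -}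

module Defs where

open import Level using (0ℓ)
open import Data.Product using (_×_; Σ; _,_)
open import Data.Sum using (_⊎_)
open import Relation.Nullary using (¬_)
open import Relation.Binary.Core using (Rel)
open import Relation.Binary.Structures using (IsEquivalence)
open import Relation.Binary.Construct.Closure.Equivalence using (EqClosure)

-- A partition on U, represented by its "same block" equivalence relation
-- (blocks = equivalence classes, which are nonempty, disjoint, and cover U).
record Partition (U : Set) : Set₁ where
  field
    sameBlock : Rel U 0ℓ
    isEquiv   : IsEquivalence sameBlock

PairSet : Set → Set₁
PairSet U = Rel U 0ℓ

module _ {U : Set} where

  compl : PairSet U → PairSet U
  compl S x y = ¬ S x y

  _∪ˢ_ : PairSet U → PairSet U → PairSet U
  (S ∪ˢ T) x y = S x y ⊎ T x y

  _∩ˢ_ : PairSet U → PairSet U → PairSet U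
  (S ∩ˢ T) x y = S x y × T x y

  closure : PairSet U → PairSet U
  closure S = EqClosure S

  int : PairSet U → PairSet U
  int S = compl (closure (compl S))

  dit : Partition U → PairSet U
  dit π x y = ¬ Partition.sameBlock π x y

  -- operations on dit sets (partitions are identified with their dit sets)
  _∨ᵈ_ : PairSet U → PairSet U → PairSet U
  S ∨ᵈ T = S ∪ˢ T

  _∧ᵈ_ : PairSet U → PairSet U → PairSet U
  S ∧ᵈ T = int (S ∩ˢ T)

  _⇒ᵈ_ : PairSet U → PairSet U → PairSet U
  S ⇒ᵈ T = int (compl S ∪ˢ T)

  ∂ : PairSet U → PairSet U → PairSet U
  ∂ π σ = σ ∨ᵈ (σ ⇒ᵈ π)

  infix 4 _≐_
  _≐_ : PairSet U → PairSet U → Set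
  S ≐ T = ∀ x y → (S x y → T x y) × (T x y → S x y)

module Submission where

open import Defs
open import Data.Product using (Σ; _×_; _,_)
open import Data.Sum using (inj₁; inj₂; [_,_])
open import Data.Empty using (⊥-elim)
open import Relation.Nullary using (¬_; Dec; yes; no)
open import Relation.Binary.Core using (_⇒_)
open import Relation.Binary.Structures using (IsEquivalence)
open import Relation.Binary.PropositionalEquality using (_≡_)
open import Relation.Binary.Construct.Closure.Equivalence using (fold; return)
import Relation.Binary.Construct.Intersection as Intersection

-- The complement of dit σ ∨ᵈ dit π is the equivalence relation E "same block in
-- both σ and π", and the complement of A ∧ᵈ B is the closure of the pairs outside
-- A ∩ B.  Since E ⊆ ∁(A ∩ B), it suffices that every pair outside A or outside B
-- lies in E.  Outside A = σ ∨ (σ ⇒ π) a pair is σ-related, and π-related because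
-- non-dits of any τ ⇒ π are generated by non-dits of π.  Outside B = (σ ⇒ π) ⇒ π
-- a pair is in the closure of pairs that are dits of σ ⇒ π but not of π; such a
-- pair cannot be a dit of σ, since modus ponens would make it a dit of π.

open Partition using (sameBlock; isEquiv)

module _ {U : Set} where

  ≐-trans : {R S T : PairSet U} → R ≐ S → S ≐ T → R ≐ T
  ≐-trans R≐S S≐T x y with R≐S x y | S≐T x y
  ... | R→S , S→R | S→T , T→S = (λ r → S→T (R→S r)) , (λ t → S→R (T→S t))

  int-≐-compl : {S E : PairSet U} → IsEquivalence E →
                compl S ⇒ E → E ⇒ compl S → int S ≐ compl E
  int-≐-compl E-equiv ∁S⇒E E⇒∁S x y =
    (λ ¬∁S e → ¬∁S (return (E⇒∁S e))) , (λ ¬e c → ¬e (fold E-equiv ∁S⇒E c))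

  ⇒ᵈ-mp : {S T : PairSet U} {x y : U} → (S ⇒ᵈ T) x y → S x y → ¬ ¬ T x y
  ⇒ᵈ-mp S⇒T s ¬t = S⇒T (return [ (λ ¬s → ¬s s) , ¬t ])

  module Classical (lem : (P : Set) → Dec P) where

    dne : {A : Set} → ¬ ¬ A → A
    dne {A} ¬¬a with lem A
    ... | yes a = a
    ... | no ¬a = ⊥-elim (¬¬a ¬a)

    ¬⇒ᵈ-sameBlock : (T : PairSet U) (π : Partition U) {x y : U} →
                    ¬ (T ⇒ᵈ dit π) x y → sameBlock π x y
    ¬⇒ᵈ-sameBlock T π ¬T⇒π =
      fold (isEquiv π) (λ ¬[∁T∪π] → dne (λ ¬s → ¬[∁T∪π] (inj₂ ¬s))) (dne ¬T⇒π)

    ⇒ᵈ-sameBlock : (σ π : Partition U) {x y : U} →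
                   (dit σ ⇒ᵈ dit π) x y → sameBlock π x y → sameBlock σ x y
    ⇒ᵈ-sameBlock σ π σ⇒π p = dne (λ ¬s → ⇒ᵈ-mp σ⇒π ¬s (λ ¬p → ¬p p))

    compl-meet-≐-∨ᵈ : (σ π : Partition U) →
                      compl (sameBlock σ ∩ˢ sameBlock π) ≐ (dit σ ∨ᵈ dit π)
    compl-meet-≐-∨ᵈ σ π x y =
      (λ ¬[s∩p] → dne (λ ¬∨ →
         ¬[s∩p] (dne (λ ¬s → ¬∨ (inj₁ ¬s)) , dne (λ ¬p → ¬∨ (inj₂ ¬p))))) ,
      (λ { (inj₁ ¬s) (s , _) → ¬s s ; (inj₂ ¬p) (_ , p) → ¬p p })

    module _ (σ π : Partition U) where

      private
        A = ∂ (dit π) (dit σ)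
        B = (dit σ ⇒ᵈ dit π) ⇒ᵈ dit π
        E = sameBlock σ ∩ˢ sameBlock π

      E-isEquivalence : IsEquivalence E
      E-isEquivalence = Intersection.isEquivalence (isEquiv σ) (isEquiv π)

      compl-∂-⊆-meet : compl A ⇒ E
      compl-∂-⊆-meet ¬A =
        dne (λ ¬s → ¬A (inj₁ ¬s)) , ¬⇒ᵈ-sameBlock (dit σ) π (λ σ⇒π → ¬A (inj₂ σ⇒π))

      compl-⇒⇒-⊆-meet : compl B ⇒ E
      compl-⇒⇒-⊆-meet ¬B = fold E-isEquivalence gen⇒E (dne ¬B)
        where
        gen⇒E : compl (compl (dit σ ⇒ᵈ dit π) ∪ˢ dit π) ⇒ E
        gen⇒E ¬gen = ⇒ᵈ-sameBlock σ π (dne (λ ¬σ⇒π → ¬gen (inj₁ ¬σ⇒π))) p , p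
          where p = dne (λ ¬p → ¬gen (inj₂ ¬p))

      compl-∩-⊆-meet : compl (A ∩ˢ B) ⇒ E
      compl-∩-⊆-meet {x} {y} ¬A∩B with lem (A x y) | lem (B x y)
      ... | yes a | yes b = ⊥-elim (¬A∩B (a , b))
      ... | no ¬a | _     = compl-∂-⊆-meet ¬a
      ... | _     | no ¬b = compl-⇒⇒-⊆-meet ¬b

      meet-⊆-compl-∩ : E ⇒ compl (A ∩ˢ B)
      meet-⊆-compl-∩ (s , _) (inj₁ ¬s , _)  = ¬s s
      meet-⊆-compl-∩ (_ , p) (inj₂ σ⇒π , b) = ⇒ᵈ-mp b σ⇒π (λ ¬p → ¬p p)

mainTheorem18 : (lem : (P : Set) → Dec P) →
    (U : Set) → Σ U (λ a → Σ U (λ b → ¬ (a ≡ b))) →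
    (σ π : Partition U) →
    (∂ (dit π) (dit σ) ∧ᵈ ((dit σ ⇒ᵈ dit π) ⇒ᵈ dit π)) ≐ (dit σ ∨ᵈ dit π)
mainTheorem18 lem U _ σ π =
  ≐-trans (int-≐-compl (E-isEquivalence σ π) (compl-∩-⊆-meet σ π) (meet-⊆-compl-∩ σ π))
          (compl-meet-≐-∨ᵈ σ π)
  where open Classical lem
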